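{- Let $a,b,e\in\mathbb Z$ with $a\neq 0$ and $e>0$, and let $h_2(j)=aj^2+bj+e$ for $j\in\mathbb Z_{\geq 0}$, where it is assumed that $h_2(j)\geq 0$ for all $j\geq 0$ (so $h_2\in\mathcal H_0$). Then $\operatorname{hdepth}(h_2)\leq 13$. In particular, there is a constant $C>0$ such that $\operatorname{hdepth}(h)\leq C$ for every $h\in\mathcal H_0$ of the form $h(j)=a_2j^2+a_1j+a_0$ with $a_i\in\mathbb Z$ and $a_0>0$.
   Context: $\mathcal H_0$ denotes the set of functions $h:\mathbb Z_{\geq 0}\to\mathbb Z_{\geq 0}$ with $h(0)>0$. For $h\in\mathcal H_0$ and integers $0\leq k\leq d$, set $\beta_k^d(h)=\sum_{j=0}^k(-1)^{k-j}\binom{d-j}{k-j}h(j)$. The Hilbert depth of $h$ is $\operatorname{hdepth}(h)=\max\{d\in\mathbb Z_{\geq 0}\;:\;\beta_k^d(h)\geq 0\text{ for all }0\leq k\leq d\}$. -}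

module Defs where

open import Data.Nat using (ℕ; zero; suc; _≤_; _<_)
open import Data.Integer using (ℤ; +_; _+_; _*_; -_; _≥_; 0ℤ)
open import Data.Nat.Combinatorics using (_C_)
open import Data.Product using (_×_)

sign : ℕ → ℤ
sign zero = + 1
sign (suc n) = - sign n

sumTo : ℕ → (ℕ → ℤ) → ℤ
sumTo zero f = f 0
sumTo (suc k) f = sumTo k f + f (suc k)

β : (ℕ → ℕ) → ℕ → ℕ → ℤ
β h d k = sumTo k (λ j → sign (k Data.Nat.∸ j) * (+ ((d Data.Nat.∸ j) C (k Data.Nat.∸ j)) * + h j))

InH₀ : (ℕ → ℕ) → Set
InH₀ h = 0 < h 0

-- d belongs to the set whose maximum is hdepth(h):  β_k^d(h) ≥ 0 for all 0 ≤ k ≤ d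
DepthAdmissible : (ℕ → ℕ) → ℕ → Set
DepthAdmissible h d = ∀ k → k ≤ d → β h d k ≥ 0ℤ

HDepth≤ : (ℕ → ℕ) → ℕ → Set
HDepth≤ h N = ∀ d → DepthAdmissible h d → d ≤ N

-- Pascal's rule β_{k+1}^d(h) = β_{k+1}^{d+1}(h) + β_k^d(h) shows that the depths d with all
-- β_k^d(h) ≥ 0 are closed downwards, so it suffices to rule out d = 14.  There
-- 42 β_1^14 + 9 β_2^14 + β_3^14 = Δ³h(0) − 132 h(0), and the third difference of a
-- quadratic vanishes, so this non-negative combination would be negative when h(0) > 0.
module Submission where

open import Defs
open import Data.Nat using (ℕ; _≤_; _<_)
open import Data.Integer using (ℤ; +_; _+_; _*_; _>_; 0ℤ)
open import Data.Product using (_×_; ∃; ∃-syntax; _,_)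
open import Relation.Binary.PropositionalEquality using (_≡_; _≢_)

open import Data.Nat using (zero; suc; _∸_; z≤n; s≤s; _≤′_; ≤′-refl; ≤′-step; _≤?_)
import Data.Nat.Properties as ℕ
open import Data.Integer using (_-_; -_; _≥_; +<+)
import Data.Integer.Properties as ℤ
open import Data.Integer.Tactic.RingSolver using (solve-∀)
open import Algebra.Properties.CommutativeSemigroup ℤ.+-commutativeSemigroup using (xy∙z≈xz∙y)
open import Data.Nat.Combinatorics using (_C_; nCk+nC[k+1]≡[n+1]C[k+1])
open import Data.Empty using (⊥-elim)
open import Function using (_∘_; id)
open import Relation.Nullary using (¬_; yes; no)
open import Relation.Binary.PropositionalEquality using (refl; sym; trans; cong; cong₂; subst; module ≡-Reasoning)

sumTo-cong : ∀ k {f g : ℕ → ℤ} → (∀ j → j ≤ k → f j ≡ g j) → sumTo k f ≡ sumTo k g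
sumTo-cong zero    f≗g = f≗g 0 z≤n
sumTo-cong (suc k) f≗g =
  cong₂ _+_ (sumTo-cong k (λ j j≤k → f≗g j (ℕ.m≤n⇒m≤1+n j≤k))) (f≗g (suc k) ℕ.≤-refl)

sumTo-+ : ∀ k (f g : ℕ → ℤ) → sumTo k (λ j → f j + g j) ≡ sumTo k f + sumTo k g
sumTo-+ zero    f g = refl
sumTo-+ (suc k) f g = begin
  sumTo k (λ j → f j + g j) + (f (suc k) + g (suc k))
    ≡⟨ cong (_+ (f (suc k) + g (suc k))) (sumTo-+ k f g) ⟩
  (sumTo k f + sumTo k g) + (f (suc k) + g (suc k))
    ≡⟨ swap (sumTo k f) (sumTo k g) (f (suc k)) (g (suc k)) ⟩
  (sumTo k f + f (suc k)) + (sumTo k g + g (suc k)) ∎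
  where
  open ≡-Reasoning
  swap : ∀ a b c d → (a + b) + (c + d) ≡ (a + c) + (b + d)
  swap = solve-∀

βTerm : (ℕ → ℕ) → ℕ → ℕ → ℕ → ℤ
βTerm h d k j = sign (k ∸ j) * (+ ((d ∸ j) C (k ∸ j)) * + h j)

sign-pascal : ∀ m n x → sign (suc m) * (+ (n C suc m) * x)
                      ≡ sign (suc m) * (+ (suc n C suc m) * x) + sign m * (+ (n C m) * x)
sign-pascal m n x rewrite sym (nCk+nC[k+1]≡[n+1]C[k+1] n m) =
  identity (sign m) (+ (n C m)) (+ (n C suc m)) x
  where
  identity : ∀ s p q x → - s * (q * x) ≡ - s * ((p + q) * x) + s * (p * x)
  identity = solve-∀

βTerm-pascal : ∀ h {d k j} → j ≤ k → k ≤ d →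
               βTerm h d (suc k) j ≡ βTerm h (suc d) (suc k) j + βTerm h d k j
βTerm-pascal h {d} {k} {j} j≤k k≤d
  rewrite ℕ.+-∸-assoc 1 j≤k | ℕ.+-∸-assoc 1 (ℕ.≤-trans j≤k k≤d) =
  sign-pascal (k ∸ j) (d ∸ j) (+ h j)

βTerm-diagonal : ∀ h d k → βTerm h d (suc k) (suc k) ≡ βTerm h (suc d) (suc k) (suc k)
βTerm-diagonal h d k rewrite ℕ.n∸n≡0 k = refl

β-pascal : ∀ h {d k} → k ≤ d → β h d (suc k) ≡ β h (suc d) (suc k) + β h d k
β-pascal h {d} {k} k≤d = begin
  sumTo k (βTerm h d (suc k)) + βTerm h d (suc k) (suc k)
    ≡⟨ cong₂ _+_ (sumTo-cong k (λ _ j≤k → βTerm-pascal h j≤k k≤d)) (βTerm-diagonal h d k) ⟩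
  sumTo k (λ j → βTerm h (suc d) (suc k) j + βTerm h d k j) + βTerm h (suc d) (suc k) (suc k)
    ≡⟨ cong (_+ βTerm h (suc d) (suc k) (suc k)) (sumTo-+ k _ _) ⟩
  (sumTo k (βTerm h (suc d) (suc k)) + β h d k) + βTerm h (suc d) (suc k) (suc k)
    ≡⟨ xy∙z≈xz∙y (sumTo k (βTerm h (suc d) (suc k))) (β h d k) (βTerm h (suc d) (suc k) (suc k)) ⟩
  β h (suc d) (suc k) + β h d k ∎
  where open ≡-Reasoning

DepthAdmissible-pred : ∀ h {d} → DepthAdmissible h (suc d) → DepthAdmissible h d
DepthAdmissible-pred h adm zero    _    = adm 0 z≤n
DepthAdmissible-pred h adm (suc k) k<d =
  subst (_≥ 0ℤ) (sym (β-pascal h (ℕ.<⇒≤ k<d)))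
    (ℤ.+-mono-≤ (adm (suc k) (ℕ.m≤n⇒m≤1+n k<d)) (DepthAdmissible-pred h adm k (ℕ.<⇒≤ k<d)))

DepthAdmissible-antitone : ∀ h {d d′} → d ≤ d′ → DepthAdmissible h d′ → DepthAdmissible h d
DepthAdmissible-antitone h = go ∘ ℕ.≤⇒≤′
  where
  go : ∀ {d d′} → d ≤′ d′ → DepthAdmissible h d′ → DepthAdmissible h d
  go ≤′-refl      = id
  go (≤′-step d≤) = go d≤ ∘ DepthAdmissible-pred h

HDepth≤-if-¬DepthAdmissible : ∀ h {n} → ¬ DepthAdmissible h (suc n) → HDepth≤ h n
HDepth≤-if-¬DepthAdmissible h {n} ¬adm d adm with d ≤? n
... | yes d≤n = d≤n
... | no  d≰n = ⊥-elim (¬adm (DepthAdmissible-antitone h (ℕ.≰⇒> d≰n) adm))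

Δ³ : (ℕ → ℤ) → ℤ
Δ³ f = f 3 - + 3 * f 2 + + 3 * f 1 - f 0

Δ³-cong : ∀ {f g : ℕ → ℤ} → (∀ j → f j ≡ g j) → Δ³ f ≡ Δ³ g
Δ³-cong f≗g =
  cong₂ _-_ (cong₂ _+_ (cong₂ _-_ (f≗g 3) (cong (+ 3 *_) (f≗g 2))) (cong (+ 3 *_) (f≗g 1))) (f≗g 0)

Δ³-quadratic : ∀ a b e → Δ³ (λ j → a * (+ j * + j) + b * + j + e) ≡ 0ℤ
Δ³-quadratic = expand
  where
  expand : ∀ a b e → let q = λ (j : ℕ) → a * (+ j * + j) + b * + j + e
                     in q 3 - + 3 * q 2 + + 3 * q 1 - q 0 ≡ 0ℤ
  expand = solve-∀

β-14-1 : ∀ h → β h 14 1 ≡ + h 1 - + 14 * + h 0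
β-14-1 h = expand (+ h 0) (+ h 1)
  where
  expand : ∀ x₀ x₁ → sign 1 * (+ 14 * x₀) + sign 0 * (+ 1 * x₁) ≡ x₁ - + 14 * x₀
  expand = solve-∀

β-14-2 : ∀ h → β h 14 2 ≡ + h 2 - + 13 * + h 1 + + 91 * + h 0
β-14-2 h = expand (+ h 0) (+ h 1) (+ h 2)
  where
  expand : ∀ x₀ x₁ x₂ → sign 2 * (+ 91 * x₀) + sign 1 * (+ 13 * x₁) + sign 0 * (+ 1 * x₂)
                      ≡ x₂ - + 13 * x₁ + + 91 * x₀
  expand = solve-∀

β-14-3 : ∀ h → β h 14 3 ≡ + h 3 - + 12 * + h 2 + + 78 * + h 1 - + 364 * + h 0
β-14-3 h = expand (+ h 0) (+ h 1) (+ h 2) (+ h 3)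
  where
  expand : ∀ x₀ x₁ x₂ x₃ →
           sign 3 * (+ 364 * x₀) + sign 2 * (+ 78 * x₁) + sign 1 * (+ 12 * x₂) + sign 0 * (+ 1 * x₃)
           ≡ x₃ - + 12 * x₂ + + 78 * x₁ - + 364 * x₀
  expand = solve-∀

β-14-combination : ∀ h → + 42 * β h 14 1 + + 9 * β h 14 2 + β h 14 3 ≡ Δ³ (+_ ∘ h) - + 132 * + h 0
β-14-combination h = begin
  + 42 * β h 14 1 + + 9 * β h 14 2 + β h 14 3
    ≡⟨ cong₂ _+_ (cong₂ _+_ (cong (+ 42 *_) (β-14-1 h)) (cong (+ 9 *_) (β-14-2 h))) (β-14-3 h) ⟩
  + 42 * (x₁ - + 14 * x₀) + + 9 * (x₂ - + 13 * x₁ + + 91 * x₀)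
    + (x₃ - + 12 * x₂ + + 78 * x₁ - + 364 * x₀)
    ≡⟨ collect x₀ x₁ x₂ x₃ ⟩
  x₃ - + 3 * x₂ + + 3 * x₁ - x₀ - + 132 * x₀ ∎
  where
  open ≡-Reasoning
  x₀ x₁ x₂ x₃ : ℤ
  x₀ = + h 0
  x₁ = + h 1
  x₂ = + h 2
  x₃ = + h 3
  collect : ∀ x₀ x₁ x₂ x₃ →
            + 42 * (x₁ - + 14 * x₀) + + 9 * (x₂ - + 13 * x₁ + + 91 * x₀)
              + (x₃ - + 12 * x₂ + + 78 * x₁ - + 364 * x₀)
            ≡ x₃ - + 3 * x₂ + + 3 * x₁ - x₀ - + 132 * x₀
  collect = solve-∀

0≤42i+9j+k : ∀ {i j k} → i ≥ 0ℤ → j ≥ 0ℤ → k ≥ 0ℤ → + 42 * i + + 9 * j + k ≥ 0ℤ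
0≤42i+9j+k i≥0 j≥0 k≥0 =
  ℤ.+-mono-≤ (ℤ.+-mono-≤ (ℤ.*-monoˡ-≤-nonNeg (+ 42) i≥0) (ℤ.*-monoˡ-≤-nonNeg (+ 9) j≥0)) k≥0

¬DepthAdmissible-14 : ∀ h → + 132 * + h 0 > Δ³ (+_ ∘ h) → ¬ DepthAdmissible h 14
¬DepthAdmissible-14 h Δ³<132h₀ adm = ℤ.<⇒≱ Δ³<132h₀ (ℤ.0≤i-j⇒j≤i
  (subst (_≥ 0ℤ) (β-14-combination h)
    (0≤42i+9j+k (adm 1 (s≤s z≤n)) (adm 2 (s≤s (s≤s z≤n))) (adm 3 (s≤s (s≤s (s≤s z≤n)))))))

quadratic-HDepth≤13 : ∀ (a b e : ℤ) (h : ℕ → ℕ) → InH₀ h →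
                      (∀ j → + h j ≡ a * (+ j * + j) + b * + j + e) → HDepth≤ h 13
quadratic-HDepth≤13 a b e h h₀>0 h≡q = HDepth≤-if-¬DepthAdmissible h (¬DepthAdmissible-14 h
  (subst (+ 132 * + h 0 >_) (sym (trans (Δ³-cong h≡q) (Δ³-quadratic a b e)))
    (ℤ.*-monoˡ-<-pos (+ 132) (+<+ h₀>0))))

quadratic-InH₀ : ∀ (a b e : ℤ) (h : ℕ → ℕ) → e > 0ℤ →
                 (∀ j → + h j ≡ a * (+ j * + j) + b * + j + e) → InH₀ h
quadratic-InH₀ a b e h e>0 h≡q =
  ℤ.drop‿+<+ (subst (_> 0ℤ) (sym (trans (h≡q 0) (at-0 a b e))) e>0)
  where
  at-0 : ∀ a b e → a * (+ 0 * + 0) + b * + 0 + e ≡ e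
  at-0 = solve-∀

corollary2p10 : ((a b e : ℤ) → a ≢ 0ℤ → e > 0ℤ → (h : ℕ → ℕ)
    → (∀ j → + h j ≡ a * (+ j * + j) + b * + j + e)
    → HDepth≤ h 13)
    × (∃[ C ] (0 < C × ((a₂ a₁ a₀ : ℤ) → a₀ > 0ℤ → (h : ℕ → ℕ) → InH₀ h
    → (∀ j → + h j ≡ a₂ * (+ j * + j) + a₁ * + j + a₀)
    → HDepth≤ h C)))
corollary2p10 =
    (λ a b e _ e>0 h h≡q → quadratic-HDepth≤13 a b e h (quadratic-InH₀ a b e h e>0 h≡q) h≡q)
  , (13 , s≤s z≤n , λ a₂ a₁ a₀ _ h h₀>0 → quadratic-HDepth≤13 a₂ a₁ a₀ h h₀>0)
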